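{- (Conservation for nuclei.) Let $S$ be a set with an entailment relation $\rhd$ inductively generated by a given collection of axioms and rules, and let $j$ be a nucleus on $\rhd$. Then ${\rhd_j}\subseteq{\rhd^j}$. Moreover, the following are equivalent: (a) ${\rhd^j}\subseteq{\rhd_j}$ (i.e. ${\rhd^j}={\rhd_j}$); (b) every non-axiom rule among the rules generating $\rhd$ is compatible with $j$.
   Context: A finite set is one that can be written as $\{a_1,\dots,a_n\}$ for some $n\ge 0$; $\mathrm{Fin}(S)$ is the set of finite subsets of $S$. We write $U,V$ for $U\cup V$ and $U,b$ for $U\cup\{b\}$. An entailment relation on $S$ is a relation ${\rhd}\subseteq \mathrm{Fin}(S)\times S$ such that for all finite $U,U',V,V'\subseteq S$ and $a,b\in S$: (R) if $a\in U$ then $U\rhd a$; (T) if $V\rhd b$ and $V',b\rhd a$ then $V,V'\rhd a$; (M) if $U\rhd a$ then $U,U'\rhd a$. An entailment relation is inductively generated by axioms (pairs $U\rhd a$, i.e. rules without premisses) and rules (closure conditions: from premisses $U_1\rhd b_1,\dots,U_n\rhd b_n$ infer $U\rhd b$) if it is the least entailment relation satisfying those axioms and rules. A nucleus on $\rhd$ is a map $j\colon S\to S$ such that for all $a,b\in S$, $U\in\mathrm{Fin}(S)$: (L$j$) if $U,a\rhd jb$ then $U,ja\rhd jb$; (R$j$) if $U\rhd b$ then $U\rhd jb$. The weak $j$-extension is ${\rhd_j}$ defined by $U\rhd_j a$ iff $U\rhd ja$. The strong $j$-extension $\rhd^j$ is the entailment relation inductively generated by all axioms and rules generating $\rhd$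 together with the stability axioms $ja\rhd^j a$ for all $a\in S$. A rule that holds for $\rhd$ is called compatible with $j$ if it also holds for $\rhd_j$. -}

module Defs where

open import Data.List using (List; []; _∷_; _++_)
open import Data.List.Membership.Propositional using (_∈_)
open import Data.List.Relation.Binary.Subset.Propositional using (_⊆_)
open import Data.List.Relation.Unary.All using (All)
open import Data.Product using (_×_; _,_; Σ)
open import Data.Sum using (_⊎_)
open import Relation.Binary.PropositionalEquality using (_≡_; _≢_)

-- Finite subsets of S are represented by lists; a list U stands for the
-- finite set of its elements.  "U , a" is rendered  a ∷ U  and "U , V" is U ++ V.

record Rule (S : Set) : Set where
  constructor mkRule
  field
    premisses : List (List S × S)
    conclCtx  : List S
    concl     : S
open Rule public

-- The entailment relation inductively generated by axioms Ax and rules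
-- (an I-indexed family of rules): the least relation closed under
-- the axioms, the rules, and (R), (T), (M).  (M) is stated for arbitrary
-- supersets, which also makes the relation respect equality of the
-- underlying finite sets.
data Gen {S : Set} (Ax : List S → S → Set) {I : Set} (rules : I → Rule S)
         : List S → S → Set where
  ax   : ∀ {U a} → Ax U a → Gen Ax rules U a
  rule : ∀ (i : I) →
         All (λ p → Gen Ax rules (Data.Product.proj₁ p) (Data.Product.proj₂ p))
             (premisses (rules i)) →
         Gen Ax rules (conclCtx (rules i)) (concl (rules i))
  refl-R : ∀ {U a} → a ∈ U → Gen Ax rules U a
  trans-T : ∀ {V V′ a b} → Gen Ax rules V b → Gen Ax rules (b ∷ V′) a →
            Gen Ax rules (V ++ V′) a
  mono-M : ∀ {U U′ a} → U ⊆ U′ → Gen Ax rules U a → Gen Ax rules U′ a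

Holds : {S : Set} → (List S → S → Set) → Rule S → Set
Holds E r = All (λ p → E (Data.Product.proj₁ p) (Data.Product.proj₂ p)) (premisses r)
            → E (conclCtx r) (concl r)

record IsNucleus {S : Set} (E : List S → S → Set) (j : S → S) : Set where
  field
    Lj : ∀ U a b → E (a ∷ U) (j b) → E (j a ∷ U) (j b)
    Rj : ∀ U b → E U b → E U (j b)

WeakExt : {S : Set} → (List S → S → Set) → (S → S) → List S → S → Set
WeakExt E j U a = E U (j a)

data WithStability {S : Set} (Ax : List S → S → Set) (j : S → S) : List S → S → Set where
  old  : ∀ {U a} → Ax U a → WithStability Ax j U a
  stab : ∀ a → WithStability Ax j (j a ∷ []) a

StrongExt : {S : Set} (Ax : List S → S → Set) {I : Set} (rules : I → Rule S) →
            (S → S) → List S → S → Set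
StrongExt Ax rules j = Gen (WithStability Ax j) rules

Compatible : {S : Set} → (List S → S → Set) → (S → S) → Rule S → Set
Compatible E j r = Holds (WeakExt E j) r

NonAxiom : {S : Set} → Rule S → Set
NonAxiom r = premisses r ≢ []

-- Gen Ax rules is the least entailment relation closed under the axioms and
-- rules, so an inclusion out of it follows once the target is shown to be such
-- a relation.  The strong extension contains Gen, hence each U ▷ j a there, and
-- the stability axiom j a ▷ a cuts this down to U ▷ a.  Conversely, for a
-- nucleus j the weak extension is an entailment relation containing the axioms
-- (by (Rj)) and the stability axioms (by (R)); premiss-free rules hold in it
-- by (Rj), so it contains the strong extension exactly when the remaining rules
-- are compatible.  Compatibility is necessary since the rules hold in the strong
-- extension, which then coincides with the weak one.
module Submission where

open import Defs
open import Data.List using (List; []; _∷_; _++_)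
open import Data.List.Properties using (++-identityʳ)
open import Data.List.Relation.Unary.All as All using (All; []; _∷_)
open import Data.List.Relation.Unary.Any using (here)
open import Data.List.Membership.Propositional using (_∈_)
open import Data.List.Relation.Binary.Subset.Propositional using (_⊆_)
open import Data.Product using (_×_; _,_; proj₁; proj₂)
open import Function.Bundles using (_⇔_; mk⇔)
open import Relation.Binary.Core using (_⇒_)
open import Relation.Binary.PropositionalEquality using (refl; subst)

record IsEntailment {S : Set} (E : List S → S → Set) : Set where
  field
    reflexive  : ∀ {U a} → a ∈ U → E U a
    transitive : ∀ {V V′ a b} → E V b → E (b ∷ V′) a → E (V ++ V′) a
    monotone   : ∀ {U U′ a} → U ⊆ U′ → E U a → E U′ a

module _ {S : Set} {Ax : List S → S → Set} {I : Set} {rules : I → Rule S} where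

  Gen-isEntailment : IsEntailment (Gen Ax rules)
  Gen-isEntailment = record { reflexive = refl-R ; transitive = trans-T ; monotone = mono-M }

  module _ {E : List S → S → Set} (isEntailment : IsEntailment E)
           (axioms : Ax ⇒ E) (rules-hold : ∀ i → Holds E (rules i)) where
    open IsEntailment isEntailment

    mutual
      Gen-least : Gen Ax rules ⇒ E
      Gen-least (ax x)        = axioms x
      Gen-least (rule i ds)   = rules-hold i (Gen-least-All ds)
      Gen-least (refl-R a∈U)  = reflexive a∈U
      Gen-least (trans-T d e) = transitive (Gen-least d) (Gen-least e)
      Gen-least (mono-M s d)  = monotone s (Gen-least d)

      Gen-least-All : ∀ {ps} → All (λ p → Gen Ax rules (proj₁ p) (proj₂ p)) ps
                    → All (λ p → E (proj₁ p) (proj₂ p)) ps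
      Gen-least-All []       = []
      Gen-least-All (d ∷ ds) = Gen-least d ∷ Gen-least-All ds

Holds-transport : {S : Set} {E F : List S → S → Set} {r : Rule S} →
                  E ⇒ F → F ⇒ E → Holds E r → Holds F r
Holds-transport E⇒F F⇒E holds ds = E⇒F (holds (All.map F⇒E ds))

module _ {S : Set} {E : List S → S → Set} {j : S → S} (nucleus : IsNucleus E j) where
  open IsNucleus nucleus

  weakExt-isEntailment : IsEntailment E → IsEntailment (WeakExt E j)
  weakExt-isEntailment isE = record
    { reflexive  = λ a∈U → Rj _ _ (reflexive a∈U)
    ; transitive = λ d e → transitive d (Lj _ _ _ e)
    ; monotone   = monotone
    }
    where open IsEntailment isE

  compatible-of-nonAxiom : ∀ {r} → Holds E r → (NonAxiom r → Compatible E j r) → Compatible E j r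
  compatible-of-nonAxiom {mkRule []      _ _} holds _      [] = Rj _ _ (holds [])
  compatible-of-nonAxiom {mkRule (_ ∷ _) _ _} _     compat    = compat (λ ())

module _ {S : Set} {Ax : List S → S → Set} {I : Set} {rules : I → Rule S} {j : S → S} where

  private
    G SE : List S → S → Set
    G  = Gen Ax rules
    SE = StrongExt Ax rules j

  Gen⇒strongExt : G ⇒ SE
  Gen⇒strongExt = Gen-least Gen-isEntailment (λ x → ax (old x)) rule

  weakExt⇒strongExt : WeakExt G j ⇒ SE
  weakExt⇒strongExt {U} {a} d =
    subst (λ V → SE V a) (++-identityʳ U) (trans-T (Gen⇒strongExt d) (ax (stab a)))

  strongExt⇒weakExt : IsNucleus G j → (∀ i → Compatible G j (rules i)) → SE ⇒ WeakExt G j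
  strongExt⇒weakExt nucleus compatible =
    Gen-least (weakExt-isEntailment nucleus Gen-isEntailment) stability-closed compatible
    where
      stability-closed : WithStability Ax j ⇒ WeakExt G j
      stability-closed (old x)  = IsNucleus.Rj nucleus _ _ (ax x)
      stability-closed (stab a) = refl-R (here refl)

theorem3p8 : {S : Set} (Ax : List S → S → Set) {I : Set} (rules : I → Rule S)
    (j : S → S) → IsNucleus (Gen Ax rules) j →
    (∀ U a → WeakExt (Gen Ax rules) j U a → StrongExt Ax rules j U a)
    × ((∀ U a → StrongExt Ax rules j U a → WeakExt (Gen Ax rules) j U a)
       ⇔ (∀ (i : I) → NonAxiom (rules i) → Compatible (Gen Ax rules) j (rules i)))
theorem3p8 {S} Ax rules j nucleus =
  (λ _ _ → weakExt⇒strongExt) , mk⇔ necessary sufficient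
  where
    G : List S → S → Set
    G = Gen Ax rules

    necessary : (∀ U a → StrongExt Ax rules j U a → WeakExt G j U a)
              → ∀ i → NonAxiom (rules i) → Compatible G j (rules i)
    necessary strong⇒weak i _ =
      Holds-transport (λ {U} {a} → strong⇒weak U a) weakExt⇒strongExt (rule i)

    sufficient : (∀ i → NonAxiom (rules i) → Compatible G j (rules i))
               → ∀ U a → StrongExt Ax rules j U a → WeakExt G j U a
    sufficient compatible _ _ =
      strongExt⇒weakExt nucleus (λ i → compatible-of-nonAxiom nucleus (rule i) (compatible i))
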